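{- There exist a binary matrix $A$ and two binary column vectors $x,y$ such that $R_{bool}(A|x)=R_{bool}(A|y)=R_{bool}(A)$ but $R_{bool}(A|x,y)>R_{bool}(A)$.
   Context: A binary matrix has entries in $\{0,1\}$. The boolean rank $R_{bool}(A)$ of an $n\times m$ binary matrix $A$ is the minimal $k$ such that $A=U\cdot V$ with $U$ an $n\times k$ and $V$ a $k\times m$ binary matrix, with boolean arithmetic ($1+1=1$). $(A|x_1,\dots,x_t)$ denotes $A$ with columns $x_1,\dots,x_t$ appended. -}

module Defs where

open import Data.Bool using (Bool; true; false; _∧_; _∨_)
open import Data.Nat using (ℕ; zero; suc; _<_)
open import Data.Fin using (Fin; zero; suc; fromℕ; inject₁)
open import Data.Fin.Base using (_↑ˡ_; _↑ʳ_; splitAt)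
open import Data.Sum using (inj₁; inj₂)
open import Data.Product using (Σ; ∃; _×_)
open import Relation.Binary.PropositionalEquality using (_≡_)
open import Relation.Nullary using (¬_)

-- A binary n × m matrix: entries in {0,1} represented as Bool (false = 0, true = 1).
BMat : ℕ → ℕ → Set
BMat n m = Fin n → Fin m → Bool

BCol : ℕ → Set
BCol n = Fin n → Bool

bigOr : (k : ℕ) → (Fin k → Bool) → Bool
bigOr zero    f = false
bigOr (suc k) f = f zero ∨ bigOr k (λ l → f (suc l))

_⊙_ : {n k m : ℕ} → BMat n k → BMat k m → BMat n m
_⊙_ {k = k} U V i j = bigOr k (λ l → U i l ∧ V l j)

HasBoolFact : {n m : ℕ} → BMat n m → ℕ → Set
HasBoolFact {n} {m} A k = Σ (BMat n k) λ U → Σ (BMat k m) λ V → ∀ i j → (U ⊙ V) i j ≡ A i j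

IsBoolRank : {n m : ℕ} → BMat n m → ℕ → Set
IsBoolRank A r = HasBoolFact A r × (∀ k → k < r → ¬ HasBoolFact A k)

data LastView : {m : ℕ} → Fin (suc m) → Set where
  isOld  : {m : ℕ} (j : Fin m) → LastView (inject₁ j)
  isLast : {m : ℕ} → LastView (fromℕ m)

lastView : {m : ℕ} (j : Fin (suc m)) → LastView j
lastView {zero}  zero    = isLast
lastView {suc m} zero    = isOld zero
lastView {suc m} (suc j) with lastView j
... | isOld j' = isOld (suc j')
... | isLast   = isLast

appendCol : {n m : ℕ} → BMat n m → BCol n → BMat n (suc m)
appendCol A x i j with lastView j
... | isOld j' = A i j'
... | isLast   = x i

-- A fooling set of size s — s one-entries no two of which span an all-one
-- rectangle — forces boolean rank ≥ s: in a factorization of inner dimension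
-- k < s, by pigeonhole two of its entries are covered by the same rank-one
-- term U·l ∧ l·V, which is then one on both crossing entries as well.
-- With A = [1 1; 1 1; 1 0], x = (0,0,1), y = (1,0,1), the matrices A, (A|x),
-- (A|y) have explicit rank-2 factorizations and the fooling set
-- {(0,1), (2,0)}, while (A|x,y) has the fooling set {(0,3), (1,0), (2,2)}.
module Submission where

open import Defs
open import Data.Bool using (Bool; true; false; _∧_)
open import Data.Bool.Properties using (∨-zeroʳ) renaming (_≟_ to _≟ᵇ_)
open import Data.Fin using (Fin; zero; suc; #_)
open import Data.Fin.Properties using (pigeonhole; <⇒≢; all?) renaming (_≟_ to _≟ᶠ_)
open import Data.Nat using (ℕ; suc; _+_; _<_)
open import Data.Nat.Properties using (n<1+n)
open import Data.Product using (Σ; _×_; _,_; ∃-syntax; proj₁; uncurry)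
open import Data.Vec using (Vec; []; _∷_; lookup)
open import Relation.Binary.PropositionalEquality using (_≡_; _≢_; refl; sym; trans; cong₂)
open import Relation.Nullary using (Dec; ¬_; isYes)
open import Relation.Nullary.Decidable using (from-yes; map′; _×-dec_; _→-dec_; ¬?)

private
  variable
    n m k s : ℕ

bigOr-true⇒∃ : ∀ k (f : Fin k → Bool) → bigOr k f ≡ true → ∃[ l ] f l ≡ true
bigOr-true⇒∃ (suc k) f eq with f zero in f₀
... | true  = zero , f₀
... | false with l , fl ← bigOr-true⇒∃ k (λ l → f (suc l)) eq = suc l , fl

∃⇒bigOr-true : ∀ k (f : Fin k → Bool) (l : Fin k) → f l ≡ true → bigOr k f ≡ true
∃⇒bigOr-true (suc k) f zero    fl rewrite fl = refl
∃⇒bigOr-true (suc k) f (suc l) fl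
  rewrite ∃⇒bigOr-true k (λ l → f (suc l)) l fl = ∨-zeroʳ (f zero)

∧-true⇒× : ∀ {a b} → a ∧ b ≡ true → a ≡ true × b ≡ true
∧-true⇒× {true} {true} _ = refl , refl

⊙-true⇒∃ : (U : BMat n k) (V : BMat k m) {i : Fin n} {j : Fin m} →
           (U ⊙ V) i j ≡ true → ∃[ l ] U i l ≡ true × V l j ≡ true
⊙-true⇒∃ {k = k} U V eq with l , Uᵢₗ∧Vₗⱼ ← bigOr-true⇒∃ k _ eq = l , ∧-true⇒× Uᵢₗ∧Vₗⱼ

∃⇒⊙-true : (U : BMat n k) (V : BMat k m) {i : Fin n} {j : Fin m} (l : Fin k) →
           U i l ≡ true → V l j ≡ true → (U ⊙ V) i j ≡ true
∃⇒⊙-true {k = k} U V l Uᵢₗ Vₗⱼ = ∃⇒bigOr-true k _ l (cong₂ _∧_ Uᵢₗ Vₗⱼ)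

_≐_ : BMat n m → BMat n m → Set
A ≐ B = ∀ i j → A i j ≡ B i j

_≐?_ : (A B : BMat n m) → Dec (A ≐ B)
A ≐? B = all? λ i → all? λ j → A i j ≟ᵇ B i j

record IsFoolingSet (A : BMat n m) (row : Fin s → Fin n) (col : Fin s → Fin m) : Set where
  constructor isFoolingSet
  field
    onOnes   : ∀ a → A (row a) (col a) ≡ true
    crossing : ∀ a b → a ≢ b → A (row a) (col b) ∧ A (row b) (col a) ≡ false

isFoolingSet? : (A : BMat n m) (row : Fin s → Fin n) (col : Fin s → Fin m) →
                Dec (IsFoolingSet A row col)
isFoolingSet? A row col = map′ (uncurry isFoolingSet) (λ (isFoolingSet p q) → p , q) (
  all? (λ a → A (row a) (col a) ≟ᵇ true) ×-dec
  all? (λ a → all? λ b → ¬? (a ≟ᶠ b) →-dec (A (row a) (col b) ∧ A (row b) (col a) ≟ᵇ false)))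

foolingSet⇒¬HasBoolFact : {A : BMat n m} {row : Fin s → Fin n} {col : Fin s → Fin m} →
                          IsFoolingSet A row col → k < s → ¬ HasBoolFact A k
foolingSet⇒¬HasBoolFact {s = s} {A = A} {row} {col} (isFoolingSet onOnes crossing) k<s
                        (U , V , U⊙V≐A) =
  let a , b , a<b , sameTerm = pigeonhole k<s (λ a → proj₁ (cover a))
  in true≢false (trans (sym (sharedTerm⇒crossingOne (cover a) (cover b) sameTerm))
                       (crossing a b (<⇒≢ a<b)))
  where
  Cover : Fin s → Set
  Cover a = ∃[ l ] U (row a) l ≡ true × V l (col a) ≡ true

  cover : ∀ a → Cover a
  cover a = ⊙-true⇒∃ U V (trans (U⊙V≐A (row a) (col a)) (onOnes a))

  true≢false : true ≢ false
  true≢false ()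

  one : ∀ {i j} l → U i l ≡ true → V l j ≡ true → A i j ≡ true
  one {i} {j} l Uᵢₗ Vₗⱼ = trans (sym (U⊙V≐A i j)) (∃⇒⊙-true U V l Uᵢₗ Vₗⱼ)

  sharedTerm⇒crossingOne : ∀ {a b} ((lₐ , _) : Cover a) ((l_b , _) : Cover b) → lₐ ≡ l_b →
                           A (row a) (col b) ∧ A (row b) (col a) ≡ true
  sharedTerm⇒crossingOne (l , Uₐ , Vₐ) (.l , U_b , V_b) refl = cong₂ _∧_ (one l Uₐ V_b) (one l U_b Vₐ)

isBoolRank : {A : BMat n m} {r : ℕ} {row : Fin r → Fin n} {col : Fin r → Fin m} →
             HasBoolFact A r → IsFoolingSet A row col → IsBoolRank A r
isBoolRank factors F = factors , λ _ k<r → foolingSet⇒¬HasBoolFact F k<r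

fromRows : Vec (Vec Bool m) n → BMat n m
fromRows rows i j = lookup (lookup rows i) j

identity : BMat n n
identity i j = isYes (i ≟ᶠ j)

A : BMat 3 2
A = fromRows ((true ∷ true  ∷ []) ∷
              (true ∷ true  ∷ []) ∷
              (true ∷ false ∷ []) ∷ [])

x y : BCol 3
x = lookup (false ∷ false ∷ true ∷ [])
y = lookup (true  ∷ false ∷ true ∷ [])

U : BMat 3 2
U = fromRows ((false ∷ true  ∷ []) ∷
              (false ∷ true  ∷ []) ∷
              (true  ∷ false ∷ []) ∷ [])

U′ : BMat 3 2
U′ = fromRows ((true  ∷ true  ∷ []) ∷
               (false ∷ true  ∷ []) ∷
               (true  ∷ false ∷ []) ∷ [])

V : BMat 2 2
V = fromRows ((true ∷ false ∷ []) ∷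
              (true ∷ true  ∷ []) ∷ [])

Vₓ : BMat 2 3
Vₓ = fromRows ((true ∷ false ∷ true  ∷ []) ∷
               (true ∷ true  ∷ false ∷ []) ∷ [])

rows₂ : Fin 2 → Fin 3
rows₂ = lookup (# 0 ∷ # 2 ∷ [])

-- Shared by A, (A|x) and (A|y), which agree on their first two columns.
cols₂ : Fin 2 → Fin (2 + m)
cols₂ = lookup (# 1 ∷ # 0 ∷ [])

Axy : BMat 3 4
Axy = appendCol (appendCol A x) y

rows₃ : Fin 3 → Fin 3
rows₃ = lookup (# 0 ∷ # 1 ∷ # 2 ∷ [])

cols₃ : Fin 3 → Fin 4
cols₃ = lookup (# 3 ∷ # 0 ∷ # 2 ∷ [])

mainTheorem8 : Σ ℕ λ n → Σ ℕ λ m → Σ (BMat n m) λ A → Σ (BCol n) λ x → Σ (BCol n) λ y →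
    Σ ℕ λ r → Σ ℕ λ r' →
    IsBoolRank A r × IsBoolRank (appendCol A x) r × IsBoolRank (appendCol A y) r ×
    IsBoolRank (appendCol (appendCol A x) y) r' × r < r'
mainTheorem8 = 3 , 2 , A , x , y , 2 , 3 ,
  isBoolRank (U  , V  , from-yes ((U ⊙ V) ≐? A))
             (from-yes (isFoolingSet? A rows₂ cols₂)) ,
  isBoolRank (U  , Vₓ , from-yes ((U ⊙ Vₓ) ≐? appendCol A x))
             (from-yes (isFoolingSet? (appendCol A x) rows₂ cols₂)) ,
  isBoolRank (U′ , Vₓ , from-yes ((U′ ⊙ Vₓ) ≐? appendCol A y))
             (from-yes (isFoolingSet? (appendCol A y) rows₂ cols₂)) ,
  isBoolRank (identity , Axy , from-yes ((identity ⊙ Axy) ≐? Axy))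
             (from-yes (isFoolingSet? Axy rows₃ cols₃)) ,
  n<1+n 2
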